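{- Suppose every rule for $f$ is in de Simone format and the equation $x\parallel y\approx f(x,y)+f(y,x)$ is sound modulo bisimilarity. Let $\mu\in\mathcal A$. Then: (1) $f$ has a rule of the form $\dfrac{x_1\xrightarrow{\mu}y_1}{f(x_1,x_2)\xrightarrow{\mu}t(y_1,x_2)}$ or a rule of the form $\dfrac{x_2\xrightarrow{\mu}y_2}{f(x_1,x_2)\xrightarrow{\mu}t(x_1,y_2)}$, for some term $t$. (2) If, moreover, the target of every rule for $f$ is either a variable or of one of the forms $\nu.z$, $z+z'$, $z\parallel z'$, $f(z,z')$ (with $\nu\in\mathcal A$ and $z,z'$ distinct variables of the rule), then for every rule of $f$ of either of the two forms above, the term $t(x,y)$ is bisimilar to $x\parallel y$.
   Context: Actions: $\mathcal A=\{a,\bar a,\tau\}$ with $a\ne\bar a$, $\bar{\bar a}=a$. CCS$_f$ terms: $t::=\mathbf 0\mid x\mid \mu.t\mid t+t\mid t\parallel t\mid f(t,t)$. Semantics on closed terms: - $\mu.x\xrightarrow{\mu}x$; - from $x\xrightarrow{\mu}x'$ infer $x+y\xrightarrow{\mu}x'$, $y+x\xrightarrow{\mu}x'$, $x\parallel y\xrightarrow{\mu}x'\parallel y$ and $y\parallel x\xrightarrow{\mu}y\parallel x'$; - from $x\xrightarrow{\beta}x'$ and $y\xrightarrow{\bar\beta}y'$ ($\beta\in\{a,\bar a\}$) infer $x\parallel y\xrightarrow{\tau}x'\parallel y'$; - the rules for $f$. A rule for $f$ is in de Simone format if it has premises $\{x_i\xrightarrow{\mu_i}y_i\mid i\in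 I\}$ with $I\subseteq\{1,2\}$ and conclusion $f(x_1,x_2)\xrightarrow{\mu}t$, where the variables $x_1,x_2,y_i$ are pairwise distinct, and $t$ is a CCS$_f$ term over them with each variable occurring at most once and no $x_i$ ($i\in I$) occurring. $\underline{\leftrightarrow}$ is strong bisimilarity; $t\approx u$ is sound if $\sigma(t)\,\underline{\leftrightarrow}\,\sigma(u)$ for all closed substitutions $\sigma$, and for open terms $t\,\underline{\leftrightarrow}\,u$ means the same. In (2), $t(x,y)$ is obtained from the target by substituting $x$ and $y$ for its first and second variable argument respectively. -}

module Defs where

open import Data.Nat using (ℕ; zero; suc; _+_; _≤_)
open import Data.Bool using (Bool; true; false; if_then_else_)
open import Data.Maybe using (Maybe; just; nothing)
open import Data.Empty using (⊥)
open import Data.Fin using (Fin; zero; suc)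
open import Data.Product using (Σ; _×_; _,_; ∃)
open import Data.Sum using (_⊎_)
open import Relation.Nullary using (¬_)
open import Relation.Binary.PropositionalEquality using (_≡_; _≢_)

data Act : Set where
  a ā τ : Act

infixr 20 _·_
infixl 15 _⊕_
infixl 16 _∥_

data Term (V : Set) : Set where
  𝟎   : Term V
  var : V → Term V
  _·_ : Act → Term V → Term V
  _⊕_ : Term V → Term V → Term V
  _∥_ : Term V → Term V → Term V
  f   : Term V → Term V → Term V

subst : {V W : Set} → (V → Term W) → Term V → Term W
subst σ 𝟎       = 𝟎
subst σ (var v) = σ v
subst σ (μ · t) = μ · subst σ t
subst σ (t ⊕ u) = subst σ t ⊕ subst σ u
subst σ (t ∥ u) = subst σ t ∥ subst σ u
subst σ (f t u) = f (subst σ t) (subst σ u)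

Closed : Set
Closed = Term ⊥

-- Rules for f.  The variables of a rule are x₁ x₂ y₁ y₂ (pairwise
-- distinct); a premise  xᵢ —μᵢ→ yᵢ  is present iff premᵢ = just μᵢ.

data RVar : Set where
  x₁ x₂ y₁ y₂ : RVar

eqRV : RVar → RVar → Bool
eqRV x₁ x₁ = true
eqRV x₂ x₂ = true
eqRV y₁ y₁ = true
eqRV y₂ y₂ = true
eqRV _  _  = false

record Rule : Set where
  constructor rule
  field
    prem₁  : Maybe Act
    prem₂  : Maybe Act
    act    : Act
    target : Term RVar
open Rule public

occ : RVar → Term RVar → ℕ
occ z 𝟎       = 0
occ z (var v) = if eqRV z v then 1 else 0
occ z (μ · t) = occ z t
occ z (t ⊕ u) = occ z t + occ z u
occ z (t ∥ u) = occ z t + occ z u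
occ z (f t u) = occ z t + occ z u

-- variable condition for argument i:
--  * i ∉ I : yᵢ is not a variable of the rule, so it does not occur;
--  * i ∈ I : xᵢ does not occur in the target.
VarOK : Maybe Act → RVar → RVar → Term RVar → Set
VarOK nothing  x y t = occ y t ≡ 0
VarOK (just _) x y t = occ x t ≡ 0

DeSimone : Rule → Set
DeSimone r =
  (∀ z → occ z (target r) ≤ 1) ×
  VarOK (prem₁ r) x₁ y₁ (target r) ×
  VarOK (prem₂ r) x₂ y₂ (target r)

inst : Closed → Closed → Closed → Closed → RVar → Closed
inst p₁ p₂ q₁ q₂ x₁ = p₁
inst p₁ p₂ q₁ q₂ x₂ = p₂
inst p₁ p₂ q₁ q₂ y₁ = q₁
inst p₁ p₂ q₁ q₂ y₂ = q₂

-- premise satisfaction: if no premise, yᵢ is unused (instantiated to 𝟎)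
data Prem (R : Rule → Set) : Maybe Act → Closed → Closed → Set

data Step (R : Rule → Set) : Closed → Act → Closed → Set where
  pre   : ∀ {μ p} → Step R (μ · p) μ p
  sumˡ  : ∀ {μ p p' q} → Step R p μ p' → Step R (p ⊕ q) μ p'
  sumʳ  : ∀ {μ p q q'} → Step R q μ q' → Step R (p ⊕ q) μ q'
  parˡ  : ∀ {μ p p' q} → Step R p μ p' → Step R (p ∥ q) μ (p' ∥ q)
  parʳ  : ∀ {μ p q q'} → Step R q μ q' → Step R (p ∥ q) μ (p ∥ q')
  comm  : ∀ {p p' q q'} → Step R p a p' → Step R q ā q' → Step R (p ∥ q) τ (p' ∥ q')
  comm' : ∀ {p p' q q'} → Step R p ā p' → Step R q a q' → Step R (p ∥ q) τ (p' ∥ q')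
  frule : ∀ {r p₁ p₂ q₁ q₂} → R r →
          Prem R (prem₁ r) p₁ q₁ → Prem R (prem₂ r) p₂ q₂ →
          Step R (f p₁ p₂) (act r) (subst (inst p₁ p₂ q₁ q₂) (target r))

data Prem R where
  none : ∀ {p} → Prem R nothing p 𝟎
  some : ∀ {μ p q} → Step R p μ q → Prem R (just μ) p q

IsBisimulation : (R : Rule → Set) → (Closed → Closed → Set) → Set
IsBisimulation R B =
  ∀ p q → B p q →
    (∀ μ p' → Step R p μ p' → Σ Closed λ q' → Step R q μ q' × B p' q') ×
    (∀ μ q' → Step R q μ q' → Σ Closed λ p' → Step R p μ p' × B p' q')

Bisim : (R : Rule → Set) → Closed → Closed → Set₁
Bisim R p q = Σ (Closed → Closed → Set) λ B → IsBisimulation R B × B p q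

OpenBisim : (R : Rule → Set) {V : Set} → Term V → Term V → Set₁
OpenBisim R {V} t u = (σ : V → Closed) → Bisim R (subst σ t) (subst σ u)

X Y : Term (Fin 2)
X = var zero
Y = var (suc zero)

SoundParEq : (R : Rule → Set) → Set₁
SoundParEq R = OpenBisim R (X ∥ Y) (f X Y ⊕ f Y X)

Form₁ : Act → Rule → Set
Form₁ μ r = prem₁ r ≡ just μ × prem₂ r ≡ nothing × act r ≡ μ

Form₂ : Act → Rule → Set
Form₂ μ r = prem₁ r ≡ nothing × prem₂ r ≡ just μ × act r ≡ μ

-- t(x,y): substitute x,y for the first and second variable argument
-- (the other rule variables do not occur in the target; mapped to 𝟎)
t₁ : Rule → Term (Fin 2)
t₁ r = subst σ (target r)
  where σ : RVar → Term (Fin 2)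
        σ y₁ = X
        σ x₂ = Y
        σ _  = 𝟎

t₂ : Rule → Term (Fin 2)
t₂ r = subst σ (target r)
  where σ : RVar → Term (Fin 2)
        σ x₁ = X
        σ y₂ = Y
        σ _  = 𝟎

data SimpleTarget : Term RVar → Set where
  tvar : ∀ z → SimpleTarget (var z)
  tpre : ∀ ν z → SimpleTarget (ν · var z)
  tsum : ∀ z z' → z ≢ z' → SimpleTarget (var z ⊕ var z')
  tpar : ∀ z z' → z ≢ z' → SimpleTarget (var z ∥ var z')
  tf   : ∀ z z' → z ≢ z' → SimpleTarget (f (var z) (var z'))

-- Soundness of x ∥ y ≈ f(x,y) + f(y,x) ties every rule for f to the moves of ∥.
-- Firing a rule on instances built from 𝟎 and one-action prefixes, and matching
-- the transition in x ∥ y, reveals its premises and label; this gives (1).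
-- For (2), the same probes, compared by the lengths of the runs they admit, rule
-- out every simple target except z ∥ z' and f(z,z') over the two variables the
-- de Simone format allows. In the first case t(x,y) is x ∥ y up to commutativity.
-- In the second, the rule makes f(p,q) bisimilar to a μ-derivative of μ.p ∥ q (or
-- of μ.q ∥ p); probing this shows that f has a rule mimicking every move of x ∥ y,
-- and f(p,q) ↔ p ∥ q follows by well-founded induction on the derivatives of p, q.
module Submission where

open import Defs
open import Data.Empty using (⊥-elim)
open import Data.Fin using (zero; suc)
open import Data.Maybe using (just; nothing)
open import Data.Nat using (ℕ; zero; suc; _+_)
open import Data.Nat.Properties using (m+n≡0⇒m≡0; m+n≡0⇒n≡0)
open import Data.Product using (Σ; ∃; ∃₂; _×_; _,_; proj₁; proj₂; swap)
open import Data.Sum using (_⊎_; inj₁; inj₂)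
open import Induction.WellFounded using (Acc; acc; acc-inverse; WellFounded)
open import Relation.Nullary using (¬_)
open import Relation.Binary.PropositionalEquality as ≡ using (_≡_; _≢_; refl)

data Complementary : Act → Act → Set where
  a-ā : Complementary a ā
  ā-a : Complementary ā a

complementary-sym : ∀ {α γ} → Complementary α γ → Complementary γ α
complementary-sym a-ā = ā-a
complementary-sym ā-a = a-ā

complementary-irrefl : ∀ {α} → ¬ Complementary α α
complementary-irrefl ()

complementary-≢τ : ∀ {α γ} → Complementary α γ → α ≢ τ × γ ≢ τ
complementary-≢τ a-ā = (λ ()) , (λ ())
complementary-≢τ ā-a = (λ ()) , (λ ())

other : Act → Act
other τ = a
other a = τ
other ā = τ

other-≢ : ∀ ν → other ν ≢ ν
other-≢ τ ()
other-≢ a ()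
other-≢ ā ()

data Probe (κ : Act) : Closed → Set where
  idle : Probe κ 𝟎
  once : Probe κ (κ · 𝟎)

data Active (z z' : RVar) : RVar → Set where
  first  : Active z z' z
  second : Active z z' z'

active-y₁x₂ : ∀ w → occ x₁ (var w) ≡ 0 → occ y₂ (var w) ≡ 0 → Active y₁ x₂ w
active-y₁x₂ x₁ () _
active-y₁x₂ x₂ _ _ = second
active-y₁x₂ y₁ _ _ = first
active-y₁x₂ y₂ _ ()

active-x₁y₂ : ∀ w → occ y₁ (var w) ≡ 0 → occ x₂ (var w) ≡ 0 → Active x₁ y₂ w
active-x₁y₂ x₁ _ _ = first
active-x₁y₂ x₂ _ ()
active-x₁y₂ y₁ () _
active-x₁y₂ y₂ _ _ = second

active-y₁y₂ : ∀ w → occ x₁ (var w) ≡ 0 → occ x₂ (var w) ≡ 0 → Active y₁ y₂ w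
active-y₁y₂ x₁ () _
active-y₁y₂ x₂ _ ()
active-y₁y₂ y₁ _ _ = first
active-y₁y₂ y₂ _ _ = second

data ParLike (z z' : RVar) : Term RVar → Set where
  par      : ParLike z z' (var z ∥ var z')
  par-flip : ParLike z z' (var z' ∥ var z)
  fun      : ParLike z z' (f (var z) (var z'))
  fun-flip : ParLike z z' (f (var z') (var z))

module LTS (R : Rule → Set) where

  infix 4 _↔_
  _↔_ : Closed → Closed → Set₁
  p ↔ q = Bisim R p q

  ↔-refl : ∀ {p} → p ↔ p
  ↔-refl = _≡_ , (λ { p .p refl → (λ _ p' st → p' , st , refl) , (λ _ p' st → p' , st , refl) }) , refl

  ↔-sym : ∀ {p q} → p ↔ q → q ↔ p
  ↔-sym (B , isB , pBq) = (λ u v → B v u) , (λ u v vBu → swap (isB v u vBu)) , pBq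

  ↔-trans : ∀ {p q r} → p ↔ q → q ↔ r → p ↔ r
  ↔-trans (B , isB , pBq) (C , isC , qCr) = (λ u w → ∃ λ v → B u v × C v w) , isBC , (_ , pBq , qCr)
    where
    isBC : IsBisimulation R (λ u w → ∃ λ v → B u v × C v w)
    isBC u w (v , uBv , vCw) =
      (λ μ u' st → let (v' , st₁ , u'Bv') = proj₁ (isB u v uBv) μ u' st
                       (w' , st₂ , v'Cw') = proj₁ (isC v w vCw) μ v' st₁
                   in w' , st₂ , (v' , u'Bv' , v'Cw')) ,
      (λ μ w' st → let (v' , st₁ , v'Cw') = proj₂ (isC v w vCw) μ w' st
                       (u' , st₂ , u'Bv') = proj₂ (isB u v uBv) μ v' st₁
                   in u' , st₂ , (v' , u'Bv' , v'Cw'))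

  ↔-forth : ∀ {p q μ p'} → p ↔ q → Step R p μ p' → ∃ λ q' → Step R q μ q' × p' ↔ q'
  ↔-forth (B , isB , pBq) st = let (q' , st' , p'Bq') = proj₁ (isB _ _ pBq) _ _ st in q' , st' , (B , isB , p'Bq')

  ↔-back : ∀ {p q μ q'} → p ↔ q → Step R q μ q' → ∃ λ p' → Step R p μ p' × p' ↔ q'
  ↔-back b st = let (p' , st' , b') = ↔-forth (↔-sym b) st in p' , st' , ↔-sym b'

  enabled : ∀ {p q μ q'} → p ↔ q → Step R q μ q' → ∃ (Step R p μ)
  enabled b st = let (p' , st' , _) = ↔-back b st in p' , st'

  -- The relations witnessing the answers to all first moves, together with
  -- (p, q) itself, form a bisimulation.
  ↔-intro : ∀ {p q} →
            (∀ {μ p'} → Step R p μ p' → ∃ λ q' → Step R q μ q' × p' ↔ q') →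
            (∀ {μ q'} → Step R q μ q' → ∃ λ p' → Step R p μ p' × p' ↔ q') →
            p ↔ q
  ↔-intro {p} {q} forth back = Rel , isRel , inj₁ (refl , refl)
    where
    Move : Set
    Move = (∃₂ λ μ p' → Step R p μ p') ⊎ (∃₂ λ μ q' → Step R q μ q')

    answer : Move → ∃₂ λ u v → u ↔ v
    answer (inj₁ (_ , p' , st)) = let (q' , _ , b) = forth st in p' , q' , b
    answer (inj₂ (_ , q' , st)) = let (p' , _ , b) = back st in p' , q' , b

    Witness : Move → Closed → Closed → Set
    Witness m = proj₁ (proj₂ (proj₂ (answer m)))

    Rel : Closed → Closed → Set
    Rel u v = (u ≡ p × v ≡ q) ⊎ ∃ λ m → Witness m u v

    isRel : IsBisimulation R Rel
    isRel _ _ (inj₁ (refl , refl)) =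
      (λ μ p' st → let (q' , st' , (_ , _ , p'Bq')) = forth st in q' , st' , inj₂ (inj₁ (μ , p' , st) , p'Bq')) ,
      (λ μ q' st → let (p' , st' , (_ , _ , p'Bq')) = back st in p' , st' , inj₂ (inj₂ (μ , q' , st) , p'Bq'))
    isRel u v (inj₂ (m , uBv)) =
      let isB = proj₁ (proj₂ (proj₂ (proj₂ (answer m)))) in
      (λ μ u' st → let (v' , st' , b) = proj₁ (isB u v uBv) μ u' st in v' , st' , inj₂ (m , b)) ,
      (λ μ v' st → let (u' , st' , b) = proj₂ (isB u v uBv) μ v' st in u' , st' , inj₂ (m , b))

  ∥-comm : ∀ p q → p ∥ q ↔ q ∥ p
  ∥-comm p q = Swapped , isSwapped , (p , q , refl , refl)
    where
    Swapped : Closed → Closed → Set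
    Swapped u v = ∃₂ λ p q → u ≡ p ∥ q × v ≡ q ∥ p

    swap-step : ∀ {p q μ u'} → Step R (p ∥ q) μ u' → ∃ λ v' → Step R (q ∥ p) μ v' × Swapped u' v'
    swap-step (parˡ st)   = _ , parʳ st , (_ , _ , refl , refl)
    swap-step (parʳ st)   = _ , parˡ st , (_ , _ , refl , refl)
    swap-step (comm s t)  = _ , comm' t s , (_ , _ , refl , refl)
    swap-step (comm' s t) = _ , comm t s , (_ , _ , refl , refl)

    isSwapped : IsBisimulation R Swapped
    isSwapped _ _ (_ , _ , refl , refl) =
      (λ _ _ → swap-step) ,
      (λ _ _ st → let (u' , st' , (p' , q' , e , e')) = swap-step st in u' , st' , (q' , p' , e' , e))

  residual-flip : ∀ {p q μ s} → (∃ λ r → Step R (p ∥ q) μ r × s ↔ r) → ∃ λ r → Step R (q ∥ p) μ r × s ↔ r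
  residual-flip (_ , st , b) = let (r' , st' , b') = ↔-forth (∥-comm _ _) st in r' , st' , ↔-trans b b'

  infixr 5 _∷_
  data Run : ℕ → Closed → Set where
    []  : ∀ {p} → Run zero p
    _∷_ : ∀ {p μ p' n} → Step R p μ p' → Run n p' → Run (suc n) p

  run-↔ : ∀ {n p q} → p ↔ q → Run n q → Run n p
  run-↔ b []         = []
  run-↔ b (st ∷ run) = let (_ , st' , b') = ↔-back b st in st' ∷ run-↔ b' run

  𝟎∥𝟎-stuck : ∀ {μ r} → ¬ Step R (𝟎 ∥ 𝟎) μ r
  𝟎∥𝟎-stuck (parˡ ())
  𝟎∥𝟎-stuck (parʳ ())
  𝟎∥𝟎-stuck (comm () _)
  𝟎∥𝟎-stuck (comm' () _)

  probe-silent : ∀ {κ ν v v'} → κ ≢ ν → Probe κ v → ¬ Step R v ν v'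
  probe-silent κ≢ν once pre = κ≢ν refl

  prefix-∥-residual : ∀ {μ p q r} → Step R (μ · p ∥ q) μ r →
                      r ≡ p ∥ q ⊎ ∃ λ q' → Step R q μ q' × r ≡ μ · p ∥ q'
  prefix-∥-residual (parˡ pre)  = inj₁ refl
  prefix-∥-residual (parʳ st)   = inj₂ (_ , st , refl)
  prefix-∥-residual (comm () _)
  prefix-∥-residual (comm' () _)

  ∥-prefix-residual : ∀ {μ p q r} → Step R (p ∥ μ · q) μ r →
                      r ≡ p ∥ q ⊎ ∃ λ p' → Step R p μ p' × r ≡ p' ∥ μ · q
  ∥-prefix-residual (parˡ st)   = inj₂ (_ , st , refl)
  ∥-prefix-residual (parʳ pre)  = inj₁ refl
  ∥-prefix-residual (comm _ ())
  ∥-prefix-residual (comm' _ ())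

  sync-step : ∀ {α γ p q} → Complementary α γ → Step R (α · p ∥ γ · q) τ (p ∥ q)
  sync-step a-ā = comm pre pre
  sync-step ā-a = comm' pre pre

  sync-residual : ∀ {α γ p q r} → Complementary α γ → Step R (α · p ∥ γ · q) τ r → r ≡ p ∥ q
  sync-residual a-ā (comm pre pre)  = refl
  sync-residual a-ā (parˡ ())
  sync-residual a-ā (parʳ ())
  sync-residual a-ā (comm' () _)
  sync-residual ā-a (comm' pre pre) = refl
  sync-residual ā-a (parˡ ())
  sync-residual ā-a (parʳ ())
  sync-residual ā-a (comm () _)

  complement-blocked : ∀ {α γ p r} → Complementary α γ → ¬ Step R (γ · p ∥ 𝟎) α r
  complement-blocked c (parˡ pre)  = complementary-irrefl c
  complement-blocked c (parʳ ())
  complement-blocked c (comm _ ())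
  complement-blocked c (comm' _ ())

  Derivative : Closed → Closed → Set
  Derivative p' p = ∃ λ μ → Step R p μ p'

  acc-↔ : ∀ {p q} → p ↔ q → Acc Derivative q → Acc Derivative p
  acc-↔ b (acc rs) = acc λ where
    (_ , st) → let (_ , st' , b') = ↔-forth b st in acc-↔ b' (rs (_ , st'))

  acc-∥ : ∀ {p q} → Acc Derivative p → Acc Derivative q → Acc Derivative (p ∥ q)
  acc-∥ ap@(acc rp) aq@(acc rq) = acc λ where
    (_ , parˡ st)   → acc-∥ (rp (_ , st)) aq
    (_ , parʳ st)   → acc-∥ ap (rq (_ , st))
    (_ , comm s t)  → acc-∥ (rp (_ , s)) (rq (_ , t))
    (_ , comm' s t) → acc-∥ (rp (_ , s)) (rq (_ , t))

-- The probes
-- separate the non-par-like simple targets: a variable gives 𝟎 against a process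
-- that can move, a prefix a move against the stuck 𝟎 ∥ 𝟎, and a sum of depth one
-- against κ.𝟎 ∥ κ.𝟎, which has a run of length two.
module Classification (R : Rule → Set) (κ : Act) {z z' i i' : RVar}
  (active : ∀ w → occ i (var w) ≡ 0 → occ i' (var w) ≡ 0 → Active z z' w)
  (σ : Closed → Closed → RVar → Closed)
  (σ-z : ∀ u v → σ u v z ≡ u) (σ-z' : ∀ u v → σ u v z' ≡ v) where
  open LTS R

  private
    σ-diag : ∀ {u w} → Active z z' w → σ u u w ≡ u
    σ-diag first  = σ-z _ _
    σ-diag second = σ-z' _ _

    both-active : ∀ {w w'} → occ i (var w) + occ i (var w') ≡ 0 → occ i' (var w) + occ i' (var w') ≡ 0 →
                  Active z z' w × Active z z' w'
    both-active {w} o o' =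
      active _ (m+n≡0⇒m≡0 _ o) (m+n≡0⇒m≡0 _ o') ,
      active _ (m+n≡0⇒n≡0 (occ i (var w)) o) (m+n≡0⇒n≡0 (occ i' (var w)) o')

    𝟎-stuck : ¬ Run 1 𝟎
    𝟎-stuck (() ∷ _)

    sum-shallow : ¬ Run 2 (κ · 𝟎 ⊕ κ · 𝟎)
    sum-shallow (sumˡ pre ∷ () ∷ _)
    sum-shallow (sumʳ pre ∷ () ∷ _)

  parLike : ∀ {T} → (∀ {u v} → Probe κ u → Probe κ v → subst (σ u v) T ↔ u ∥ v) →
            SimpleTarget T → occ i T ≡ 0 → occ i' T ≡ 0 → ParLike z z' T
  parLike sound (tvar w) o o' with active w o o'
  ... | first  = ⊥-elim (𝟎-stuck (≡.subst (Run 1) (σ-z _ _) (run-↔ (sound idle once) (parʳ pre ∷ []))))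
  ... | second = ⊥-elim (𝟎-stuck (≡.subst (Run 1) (σ-z' _ _) (run-↔ (sound once idle) (parˡ pre ∷ []))))
  parLike sound (tpre ν w) _ _ with run-↔ (↔-sym (sound idle idle)) (pre ∷ [])
  ... | st ∷ _ = ⊥-elim (𝟎∥𝟎-stuck st)
  parLike sound (tsum w w' _) o o' with both-active o o'
  ... | act , act' = ⊥-elim (sum-shallow (≡.subst₂ (λ s s' → Run 2 (s ⊕ s')) (σ-diag act) (σ-diag act')
                                 (run-↔ (sound once once) (parˡ pre ∷ parʳ pre ∷ []))))
  parLike sound (tpar w w' w≢w') o o' with both-active o o'
  ... | first  , first  = ⊥-elim (w≢w' refl)
  ... | first  , second = par
  ... | second , first  = par-flip
  ... | second , second = ⊥-elim (w≢w' refl)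
  parLike sound (tf w w' w≢w') o o' with both-active o o'
  ... | first  , first  = ⊥-elim (w≢w' refl)
  ... | first  , second = fun
  ... | second , first  = fun-flip
  ... | second , second = ⊥-elim (w≢w' refl)

module ParallelEquation (R : Rule → Set) (deSimone : ∀ r → R r → DeSimone r) (sound : SoundParEq R) where
  open LTS R

  ∥-↔-f⊕f : ∀ p q → p ∥ q ↔ f p q ⊕ f q p
  ∥-↔-f⊕f p q = sound λ { zero → p ; (suc zero) → q }

  f-step-∥ : ∀ {p q μ s} → Step R (f p q) μ s → ∃ λ r → Step R (p ∥ q) μ r × s ↔ r
  f-step-∥ st = let (r , st' , b) = ↔-back (∥-↔-f⊕f _ _) (sumˡ st) in r , st' , ↔-sym b

  ∥-step-f : ∀ {p q μ r} → Step R (p ∥ q) μ r → ∃ λ s → (Step R (f p q) μ s ⊎ Step R (f q p) μ s) × s ↔ r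
  ∥-step-f st with ↔-forth (∥-↔-f⊕f _ _) st
  ... | s , sumˡ st' , b = s , inj₁ st' , ↔-sym b
  ... | s , sumʳ st' , b = s , inj₂ st' , ↔-sym b

  derivative-wellFounded : WellFounded Derivative
  derivative-wellFounded 𝟎       = acc λ { (_ , ()) }
  derivative-wellFounded (var ())
  derivative-wellFounded (μ · p) = acc λ { (_ , pre) → derivative-wellFounded p }
  derivative-wellFounded (p ⊕ q) = acc λ where
    (_ , sumˡ st) → acc-inverse (derivative-wellFounded p) (_ , st)
    (_ , sumʳ st) → acc-inverse (derivative-wellFounded q) (_ , st)
  derivative-wellFounded (p ∥ q) = acc-∥ (derivative-wellFounded p) (derivative-wellFounded q)
  derivative-wellFounded (f p q) = acc λ where
    (_ , st) → acc-inverse (acc-↔ (↔-sym (∥-↔-f⊕f p q)) (acc-∥ (derivative-wellFounded p) (derivative-wellFounded q)))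
                           (_ , sumˡ st)

  LeftRule RightRule : Act → Set
  LeftRule  ν = ∃ λ T → R (rule (just ν) nothing ν T)
  RightRule ν = ∃ λ T → R (rule nothing (just ν) ν T)

  SyncRule : Act → Act → Set
  SyncRule α γ = ∃ λ T → R (rule (just α) (just γ) τ T)

  no-axiom : ∀ {μ T} → ¬ R (rule nothing nothing μ T)
  no-axiom ρ = 𝟎∥𝟎-stuck (proj₁ (proj₂ (f-step-∥ (frule {p₁ = 𝟎} {p₂ = 𝟎} ρ none none))))

  left-label : ∀ {α μ T} → R (rule (just α) nothing μ T) → μ ≡ α
  left-label ρ with f-step-∥ (frule {p₂ = 𝟎} ρ (some (pre {p = 𝟎})) none)
  ... | _ , parˡ pre , _    = refl
  ... | _ , parʳ () , _
  ... | _ , comm pre () , _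
  ... | _ , comm' pre () , _

  right-label : ∀ {γ μ T} → R (rule nothing (just γ) μ T) → μ ≡ γ
  right-label ρ with f-step-∥ (frule {p₁ = 𝟎} ρ none (some (pre {p = 𝟎})))
  ... | _ , parʳ pre , _    = refl
  ... | _ , parˡ () , _
  ... | _ , comm () pre , _
  ... | _ , comm' () pre , _

  left-rule-of : ∀ {ν} → ∃ (Step R (f (ν · 𝟎) 𝟎) ν) → LeftRule ν
  left-rule-of (_ , frule {rule nothing nothing _ _} ρ none none)        = ⊥-elim (no-axiom ρ)
  left-rule-of (_ , frule {rule (just _) nothing _ T} ρ (some pre) none) = T , ρ
  left-rule-of (_ , frule {rule _ (just _) _ _} ρ _ (some ()))

  right-rule-of : ∀ {ν} → ∃ (Step R (f 𝟎 (ν · 𝟎)) ν) → RightRule ν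
  right-rule-of (_ , frule {rule nothing nothing _ _} ρ none none)        = ⊥-elim (no-axiom ρ)
  right-rule-of (_ , frule {rule nothing (just _) _ T} ρ none (some pre)) = T , ρ
  right-rule-of (_ , frule {rule (just _) _ _ _} ρ (some ()) _)

  sync-rule-of : ∀ {α γ} → Complementary α γ → ∃ (Step R (f (α · 𝟎) (γ · 𝟎)) τ) → SyncRule α γ
  sync-rule-of c (_ , frule {rule nothing nothing _ _} ρ none none) = ⊥-elim (no-axiom ρ)
  sync-rule-of c (_ , frule {rule (just _) (just _) _ T} ρ (some pre) (some pre)) = T , ρ
  sync-rule-of c (_ , frule {rule (just _) nothing _ _} ρ (some pre) none) =
    ⊥-elim (proj₁ (complementary-≢τ c) (≡.sym (left-label ρ)))
  sync-rule-of c (_ , frule {rule nothing (just _) _ _} ρ none (some pre)) =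
    ⊥-elim (proj₂ (complementary-≢τ c) (≡.sym (right-label ρ)))

  rule-for : ∀ μ → (∃ λ r → R r × Form₁ μ r) ⊎ (∃ λ r → R r × Form₂ μ r)
  rule-for μ with ∥-step-f (parˡ {q = 𝟎} (pre {μ = μ} {p = 𝟎}))
  ... | _ , inj₁ st , _ = let (_ , ρ) = left-rule-of (_ , st) in inj₁ (_ , ρ , refl , refl , refl)
  ... | _ , inj₂ st , _ = let (_ , ρ) = right-rule-of (_ , st) in inj₂ (_ , ρ , refl , refl , refl)

  fire-left : ∀ {ν T} → R (rule (just ν) nothing ν T) → ∀ u v →
              ∃ λ r → Step R (ν · u ∥ v) ν r × subst (inst (ν · u) v u 𝟎) T ↔ r
  fire-left ρ u v = f-step-∥ (frule ρ (some pre) none)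

  fire-right : ∀ {ν T} → R (rule nothing (just ν) ν T) → ∀ u v →
               ∃ λ r → Step R (u ∥ ν · v) ν r × subst (inst u (ν · v) 𝟎 v) T ↔ r
  fire-right ρ u v = f-step-∥ (frule ρ none (some pre))

  fire-left-silent : ∀ {ν T u v} → R (rule (just ν) nothing ν T) → (∀ {v'} → ¬ Step R v ν v') →
                     subst (inst (ν · u) v u 𝟎) T ↔ u ∥ v
  fire-left-silent {u = u} {v} ρ silent with fire-left ρ u v
  ... | _ , st , b with prefix-∥-residual st
  ...   | inj₁ refl          = b
  ...   | inj₂ (_ , st' , _) = ⊥-elim (silent st')

  fire-right-silent : ∀ {ν T u v} → R (rule nothing (just ν) ν T) → (∀ {u'} → ¬ Step R u ν u') →
                      subst (inst u (ν · v) 𝟎 v) T ↔ u ∥ v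
  fire-right-silent {u = u} {v} ρ silent with fire-right ρ u v
  ... | _ , st , b with ∥-prefix-residual st
  ...   | inj₁ refl          = b
  ...   | inj₂ (_ , st' , _) = ⊥-elim (silent st')

  fire-sync : ∀ {α γ T} → Complementary α γ → R (rule (just α) (just γ) τ T) → ∀ u v →
              subst (inst (α · u) (γ · v) u v) T ↔ u ∥ v
  fire-sync c ρ u v =
    let (_ , st , b) = f-step-∥ (frule ρ (some pre) (some pre)) in ≡.subst (_ ↔_) (sync-residual c st) b

  left-parLike : ∀ {ν T} → R (rule (just ν) nothing ν T) → SimpleTarget T → ParLike y₁ x₂ T
  left-parLike {ν} ρ simple =
    let (_ , o , o') = deSimone _ ρ in
    Classification.parLike R (other ν) active-y₁x₂ (λ u v → inst (ν · u) v u 𝟎) (λ _ _ → refl) (λ _ _ → refl)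
      (λ _ v → fire-left-silent ρ (probe-silent (other-≢ ν) v)) simple o o'

  right-parLike : ∀ {ν T} → R (rule nothing (just ν) ν T) → SimpleTarget T → ParLike x₁ y₂ T
  right-parLike {ν} ρ simple =
    let (_ , o , o') = deSimone _ ρ in
    Classification.parLike R (other ν) active-x₁y₂ (λ u v → inst u (ν · v) 𝟎 v) (λ _ _ → refl) (λ _ _ → refl)
      (λ u _ → fire-right-silent ρ (probe-silent (other-≢ ν) u)) simple o o'

  sync-parLike : ∀ {α γ T} → Complementary α γ → R (rule (just α) (just γ) τ T) → SimpleTarget T → ParLike y₁ y₂ T
  sync-parLike {α} {γ} c ρ simple =
    let (_ , o , o') = deSimone _ ρ in
    Classification.parLike R τ active-y₁y₂ (λ u v → inst (α · u) (γ · v) u v) (λ _ _ → refl) (λ _ _ → refl)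
      (λ _ _ → fire-sync c ρ _ _) simple o o'

  record ParRules : Set where
    field
      left  : ∀ ν → LeftRule ν
      right : ∀ ν → RightRule ν
      sync  : ∀ {α γ} → Complementary α γ → SyncRule α γ

  LeftDerivative RightDerivative : Act → Set₁
  LeftDerivative  μ = ∀ p q → ∃ λ r → Step R (μ · p ∥ q) μ r × f p q ↔ r
  RightDerivative μ = ∀ p q → ∃ λ r → Step R (μ · q ∥ p) μ r × f p q ↔ r

  leftDerivative-rules : ∀ {μ} → LeftDerivative μ → ParRules
  leftDerivative-rules {μ} G = record { left = lefts ; right = rights ; sync = syncs }
    where
    lefts : ∀ ν → LeftRule ν
    lefts ν with G (ν · 𝟎) 𝟎
    ... | _ , st , b with prefix-∥-residual st
    ...   | inj₁ refl         = left-rule-of (enabled b (parˡ pre))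
    ...   | inj₂ (_ , () , _)

    rights : ∀ ν → RightRule ν
    rights ν with G 𝟎 (ν · 𝟎)
    ... | _ , st , b with prefix-∥-residual st
    ...   | inj₁ refl             = right-rule-of (enabled b (parʳ pre))
    ...   | inj₂ (_ , pre , refl) = right-rule-of (enabled b (parˡ pre))

    -- If μ is the complement γ, then f(α.𝟎, γ.𝟎) ↔ γ.α.𝟎 ∥ 𝟎, which cannot match the α-move of the left rule.
    syncs : ∀ {α γ} → Complementary α γ → SyncRule α γ
    syncs {α} {γ} c with G (α · 𝟎) (γ · 𝟎)
    ... | _ , st , b with prefix-∥-residual st
    ...   | inj₁ refl             = sync-rule-of c (enabled b (sync-step c))
    ...   | inj₂ (_ , pre , refl) =
      ⊥-elim (complement-blocked c (proj₁ (proj₂ (↔-forth b (frule (proj₂ (lefts α)) (some pre) none)))))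

  rightDerivative-rules : ∀ {μ} → RightDerivative μ → ParRules
  rightDerivative-rules {μ} G = record { left = lefts ; right = rights ; sync = syncs }
    where
    lefts : ∀ ν → LeftRule ν
    lefts ν with G (ν · 𝟎) 𝟎
    ... | _ , st , b with prefix-∥-residual st
    ...   | inj₁ refl             = left-rule-of (enabled b (parʳ pre))
    ...   | inj₂ (_ , pre , refl) = left-rule-of (enabled b (parˡ pre))

    rights : ∀ ν → RightRule ν
    rights ν with G 𝟎 (ν · 𝟎)
    ... | _ , st , b with prefix-∥-residual st
    ...   | inj₁ refl         = right-rule-of (enabled b (parˡ pre))
    ...   | inj₂ (_ , () , _)

    syncs : ∀ {α γ} → Complementary α γ → SyncRule α γ
    syncs {α} {γ} c with G (α · 𝟎) (γ · 𝟎)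
    ... | _ , st , b with prefix-∥-residual st
    ...   | inj₁ refl             = sync-rule-of c (enabled b (sync-step (complementary-sym c)))
    ...   | inj₂ (_ , pre , refl) =
      ⊥-elim (complement-blocked (complementary-sym c)
                (proj₁ (proj₂ (↔-forth b (frule (proj₂ (rights γ)) none (some pre))))))

  FIsPar : Closed → Closed → Set₁
  FIsPar u v = (f u v ↔ u ∥ v) × (f v u ↔ v ∥ u)

  parLike-↔ : ∀ {z z' T} → ParLike z z' T → ∀ σ → FIsPar (σ z) (σ z') → subst σ T ↔ σ z ∥ σ z'
  parLike-↔ par      σ _       = ↔-refl
  parLike-↔ par-flip σ _       = ∥-comm _ _
  parLike-↔ fun      σ (h , _) = h
  parLike-↔ fun-flip σ (_ , h) = ↔-trans h (∥-comm _ _)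

  module WithSimpleTargets (simple : ∀ r → R r → SimpleTarget (target r)) where

    module _ (rules : ParRules) where
      open ParRules rules

      mimic : ∀ {p q} →
              (∀ {ν p'} → Step R p ν p' → FIsPar p' q) →
              (∀ {ν q'} → Step R q ν q' → FIsPar p q') →
              (∀ {α γ p' q'} → Step R p α p' → Step R q γ q' → FIsPar p' q') →
              ∀ {ν r} → Step R (p ∥ q) ν r → ∃ λ s → Step R (f p q) ν s × s ↔ r
      mimic {p} {q} ihˡ _ _ (parˡ {μ = ν} {p' = p'} st) =
        let (_ , ρ) = left ν in
        _ , frule ρ (some st) none , parLike-↔ (left-parLike ρ (simple _ ρ)) (inst p q p' 𝟎) (ihˡ st)
      mimic {p} {q} _ ihʳ _ (parʳ {μ = ν} {q' = q'} st) =
        let (_ , ρ) = right ν in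
        _ , frule ρ none (some st) , parLike-↔ (right-parLike ρ (simple _ ρ)) (inst p q 𝟎 q') (ihʳ st)
      mimic {p} {q} _ _ ihˢ (comm {p' = p'} {q' = q'} s t) =
        let (_ , ρ) = sync a-ā in
        _ , frule ρ (some s) (some t) , parLike-↔ (sync-parLike a-ā ρ (simple _ ρ)) (inst p q p' q') (ihˢ s t)
      mimic {p} {q} _ _ ihˢ (comm' {p' = p'} {q' = q'} s t) =
        let (_ , ρ) = sync ā-a in
        _ , frule ρ (some s) (some t) , parLike-↔ (sync-parLike ā-a ρ (simple _ ρ)) (inst p q p' q') (ihˢ s t)

      f-↔-∥-acc : ∀ {p q} → Acc Derivative p → Acc Derivative q → FIsPar p q
      f-↔-∥-acc {p} {q} ap@(acc rp) aq@(acc rq) =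
        ↔-intro f-step-∥ (mimic ihˡ ihʳ ihˢ) ,
        ↔-intro f-step-∥ (mimic (λ st → swap (ihʳ st)) (λ st → swap (ihˡ st)) (λ s t → swap (ihˢ t s)))
        where
        ihˡ : ∀ {ν p'} → Step R p ν p' → FIsPar p' q
        ihˡ st = f-↔-∥-acc (rp (_ , st)) aq
        ihʳ : ∀ {ν q'} → Step R q ν q' → FIsPar p q'
        ihʳ st = f-↔-∥-acc ap (rq (_ , st))
        ihˢ : ∀ {α γ p' q'} → Step R p α p' → Step R q γ q' → FIsPar p' q'
        ihˢ s t = f-↔-∥-acc (rp (_ , s)) (rq (_ , t))

      f-↔-∥ : ∀ p q → f p q ↔ p ∥ q
      f-↔-∥ p q = proj₁ (f-↔-∥-acc (derivative-wellFounded p) (derivative-wellFounded q))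

    left-target-↔ : ∀ {μ T} → R (rule (just μ) nothing μ T) → OpenBisim R (t₁ (rule (just μ) nothing μ T)) (X ∥ Y)
    left-target-↔ ρ with left-parLike ρ (simple _ ρ)
    ... | par      = λ _ → ↔-refl
    ... | par-flip = λ _ → ∥-comm _ _
    ... | fun      = λ _ → f-↔-∥ (leftDerivative-rules (fire-left ρ)) _ _
    ... | fun-flip = λ _ → ↔-trans (f-↔-∥ (rightDerivative-rules λ p q → fire-left ρ q p) _ _) (∥-comm _ _)

    right-target-↔ : ∀ {μ T} → R (rule nothing (just μ) μ T) → OpenBisim R (t₂ (rule nothing (just μ) μ T)) (X ∥ Y)
    right-target-↔ ρ with right-parLike ρ (simple _ ρ)
    ... | par      = λ _ → ↔-refl
    ... | par-flip = λ _ → ∥-comm _ _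
    ... | fun      = λ _ → f-↔-∥ (rightDerivative-rules λ p q → residual-flip (fire-right ρ p q)) _ _
    ... | fun-flip = λ _ → ↔-trans (f-↔-∥ (leftDerivative-rules λ p q → residual-flip (fire-right ρ q p)) _ _)
                                   (∥-comm _ _)

    form₁-target-↔ : ∀ {μ} r → R r → Form₁ μ r → OpenBisim R (t₁ r) (X ∥ Y)
    form₁-target-↔ (rule _ _ _ _) ρ (refl , refl , refl) = left-target-↔ ρ

    form₂-target-↔ : ∀ {μ} r → R r → Form₂ μ r → OpenBisim R (t₂ r) (X ∥ Y)
    form₂-target-↔ (rule _ _ _ _) ρ (refl , refl , refl) = right-target-↔ ρ

lemma5 : (R : Rule → Set) →
         (∀ r → R r → DeSimone r) →
         SoundParEq R →
         (μ : Act) →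
         ((Σ Rule λ r → R r × Form₁ μ r) ⊎ (Σ Rule λ r → R r × Form₂ μ r)) ×
         ((∀ r → R r → SimpleTarget (target r)) →
            ∀ r → R r →
              (Form₁ μ r → OpenBisim R (t₁ r) (X ∥ Y)) ×
              (Form₂ μ r → OpenBisim R (t₂ r) (X ∥ Y)))
lemma5 R deSimone sound μ =
  rule-for μ ,
  λ simple r ρ → let open WithSimpleTargets simple in form₁-target-↔ r ρ , form₂-target-↔ r ρ
  where open ParallelEquation R deSimone sound
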